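{- Let $D=(\mathcal P,\mathcal B)$ be an incidence structure with $|\mathcal P|=v$. Then $\gamma_e(D)\le v$. If $D$ is a $(v,k,\lambda)$-design in which every point is incident with $r$ blocks, then $\gamma_e(D)=v$ if and only if $r\ge v$.
   Context: An incidence structure is a pair $D=(\mathcal P,\mathcal B)$ where $\mathcal B$ is a collection of subsets (blocks) of $\mathcal P$. A $(v,k,\lambda)$-design is an incidence structure with $v$ points, every block containing $k$ points, every point in $r$ blocks, and any two distinct points contained in exactly $\lambda\ge1$ common blocks. The incidence graph $I(D)$ is the bipartite graph on $\mathcal P\cup\mathcal B$ with $P\sim B$ iff $P\in B$. An edge dominating set of a graph is a set $\Gamma$ of edges such that every edge shares a vertex with some edge of $\Gamma$; $\gamma_e(D)$ is the minimum size of an edge dominating set of $I(D)$. -}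

module Defs where

open import Data.Nat using (ℕ; _≤_; _≥_)
open import Data.Fin using (Fin)
open import Data.Fin.Subset using (Subset; _∈_; ∣_∣)
open import Data.Bool using (_∧_)
open import Data.Vec using (tabulate; lookup)
open import Data.Product using (_×_; _,_; Σ; ∃)
open import Data.Sum using (_⊎_)
open import Data.List using (List; length)
open import Data.List.Relation.Unary.All using (All)
open import Data.List.Relation.Unary.Any using (Any)
open import Data.List.Relation.Unary.Unique.Propositional using (Unique)
open import Relation.Binary.PropositionalEquality using (_≡_; _≢_)

-- An incidence structure with point set Fin v and b blocks, each block a
-- subset of the points (blocks are indexed, so repeated blocks are allowed).
IncStr : ℕ → ℕ → Set
IncStr v b = Fin b → Subset v

IsEdge : ∀ {v b} → IncStr v b → Fin v × Fin b → Set
IsEdge D (p , B) = p ∈ D B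

-- Two edges share a vertex (the graph is bipartite, so a common vertex is
-- either a common point or a common block).
ShareVertex : ∀ {v b} → Fin v × Fin b → Fin v × Fin b → Set
ShareVertex (p , B) (q , C) = p ≡ q ⊎ B ≡ C

record EdgeDomSet {v b} (D : IncStr v b) : Set where
  field
    edges     : List (Fin v × Fin b)
    areEdges  : All (IsEdge D) edges
    distinct  : Unique edges
    dominates : ∀ e → IsEdge D e → Any (ShareVertex e) edges

size : ∀ {v b} {D : IncStr v b} → EdgeDomSet D → ℕ
size Γ = length (EdgeDomSet.edges Γ)

IsEdgeDomNumber : ∀ {v b} → IncStr v b → ℕ → Set
IsEdgeDomNumber D n =
  Σ (EdgeDomSet D) (λ Γ → size Γ ≡ n) × (∀ (Γ : EdgeDomSet D) → n ≤ size Γ)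

blocksThrough : ∀ {v b} → IncStr v b → Fin v → Subset b
blocksThrough D p = tabulate (λ B → lookup (D B) p)

blocksThrough₂ : ∀ {v b} → IncStr v b → Fin v → Fin v → Subset b
blocksThrough₂ D p q = tabulate (λ B → lookup (D B) p ∧ lookup (D B) q)

record IsDesign {v b} (D : IncStr v b) (k r lam : ℕ) : Set where
  field
    blockSize : ∀ B → ∣ D B ∣ ≡ k
    replication : ∀ p → ∣ blocksThrough D p ∣ ≡ r
    balanced : ∀ p q → p ≢ q → ∣ blocksThrough₂ D p q ∣ ≡ lam
    lam≥1 : lam ≥ 1

-- Choosing one block through every point that lies on some block gives an
-- edge dominating set with at most v edges; a minimum one exists because the
-- edge sets of I(D) can be searched exhaustively.
--
-- In a design, an edge dominating set either meets all v points, or misses a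
-- point p and then meets all r blocks through p; so γ_e(D) = v when r ≥ v.
-- When r < v, counting flags through p gives r (k - 1) = (v - 1) λ, hence
-- λ ≤ k - 1, and the blocks through p, with p deleted, satisfy Hall's
-- condition against the other points. Matching each block through p to a
-- point q ≠ p on it, and letting every q ≠ p carry its matched block (or any
-- block through q), gives an edge dominating set with v - 1 edges.

module Submission where

open import Defs
open import Data.Nat.Properties using (+-*-semiring)
open import Algebra.Properties.Semiring.Sum +-*-semiring
  using (sum; sum-syntax; ∑-comm; sum-cong-≗; *-distribˡ-sum; *-distribʳ-sum)
open import Data.Bool using (_∧_; if_then_else_)
open import Data.Bool.Properties using (∧-conicalˡ; ∧-conicalʳ)
open import Data.Fin using (Fin; zero; suc; _≟_; combine; remQuot)
open import Data.Fin.Properties using (any?; all?; ¬∀⟶∃¬; remQuot-combine)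
open import Data.Fin.Subset
  using (Subset; inside; outside; _∈_; _∉_; _⊆_; _∪_; _∩_; _─_; _-_; ⁅_⁆; ⊥; ⊤; ∣_∣; Nonempty; Empty)
open import Data.Fin.Subset.Properties
  using (_∈?_; _⊆?_; nonempty?; anySubset?; ∉⊥; ∈⊤; ∣⊤∣≡n; ∣⊥∣≡0; Empty-unique; ⊆-trans; ⊆-antisym;
         x∈p∪q⁺; x∈p∪q⁻; x∈p∩q⁺; x∈p∩q⁻; x∈⁅x⁆; x∈⁅y⁆⇒x≡y; ∣⁅x⁆∣≡1; p─⊥≡p; p─q⊆p;
         x∈p∧x≢y⇒x∈p-y; x∈p∧x∉q⇒x∈p─q; p⊆q⇒∣p∣≤∣q∣; x∈p⇒∣p-x∣<∣p∣; p∩q≢∅⇒∣p─q∣<∣p∣)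
open import Data.List using (List; []; _∷_; length; map; filter; mapMaybe; allFin; cartesianProduct)
open import Data.List.Properties using (filter-notAll; length-map; length-tabulate; length-mapMaybe)
open import Data.List.Membership.Propositional using (find; lose) renaming (_∈_ to _∈ˡ_)
open import Data.List.Membership.Propositional.Properties
  using (∈-map⁺; ∈-map⁻; ∈-filter⁺; ∈-filter⁻; ∈-allFin; ∈-cartesianProduct⁺)
open import Data.List.Relation.Unary.All as All using (All)
open import Data.List.Relation.Unary.AllPairs using ([]; _∷_)
open import Data.List.Relation.Unary.Any as Any using (Any; here; there)
open import Data.List.Relation.Unary.Unique.Propositional using (Unique)
import Data.List.Relation.Unary.Unique.Propositional.Properties as Unique
open import Data.Maybe as Maybe using (Maybe; just; nothing)
open import Data.Maybe.Properties using (just-injective)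
open import Data.Nat
  using (ℕ; zero; suc; _+_; _*_; _∸_; _≤_; _<_; _≥_; _≤?_; _<?_; z≤n; s≤s; NonZero; >-nonZero)
open import Data.Nat.Properties
  using (≤-refl; ≤-reflexive; n≤1+n; +-suc; ≤-trans; ≤-antisym; ≤-pred; m≤n⇒m≤1+n; ≮⇒≥; ≰⇒>; <⇒≱;
         +-identityʳ; +-mono-≤; +-monoʳ-≤; +-cancelʳ-≤; *-monoʳ-≤; *-monoˡ-≤; *-cancelʳ-≤; *-cancelˡ-≤;
         suc-injective; module ≤-Reasoning)
open import Data.Product using (_×_; _,_; ∃; proj₁; proj₂; uncurry)
open import Data.Product.Properties using (≡-dec)
open import Data.Sum using (_⊎_; inj₁; inj₂)
open import Data.Vec using (_∷_; []; lookup; tabulate)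
open import Data.Vec.Properties using (lookup-zipWith; lookup∘tabulate; []=⇒lookup; lookup⇒[]=)
open import Function using (_∘_)
open import Function.Bundles using (_⇔_; mk⇔)
open import Relation.Binary.Definitions using (DecidableEquality)
open import Relation.Binary.PropositionalEquality
open import Relation.Nullary using (¬?; Dec; yes; no; contradiction)
open import Relation.Nullary.Decidable using (_×-dec_; _⊎-dec_; _→-dec_; map′; dec⇒maybe)
open import Relation.Unary using (Decidable)

open Data.Vec._[_]=_

private variable
  m n : ℕ
  A B : Set

-- Cardinality and counting in finite subsets

∣p∪q∣≤∣p∣+∣q∣ : ∀ (p q : Subset n) → ∣ p ∪ q ∣ ≤ ∣ p ∣ + ∣ q ∣
∣p∪q∣≤∣p∣+∣q∣ []            []            = z≤n
∣p∪q∣≤∣p∣+∣q∣ (inside  ∷ p) (inside  ∷ q) =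
  s≤s (≤-trans (∣p∪q∣≤∣p∣+∣q∣ p q) (+-monoʳ-≤ ∣ p ∣ (n≤1+n ∣ q ∣)))
∣p∪q∣≤∣p∣+∣q∣ (inside  ∷ p) (outside ∷ q) = s≤s (∣p∪q∣≤∣p∣+∣q∣ p q)
∣p∪q∣≤∣p∣+∣q∣ (outside ∷ p) (inside  ∷ q) =
  ≤-trans (s≤s (∣p∪q∣≤∣p∣+∣q∣ p q)) (≤-reflexive (sym (+-suc ∣ p ∣ ∣ q ∣)))
∣p∪q∣≤∣p∣+∣q∣ (outside ∷ p) (outside ∷ q) = ∣p∪q∣≤∣p∣+∣q∣ p q

∣p∪q∣≡∣p∣+∣q∣ : ∀ (p q : Subset n) → (∀ {x} → x ∈ p → x ∉ q) →
                ∣ p ∪ q ∣ ≡ ∣ p ∣ + ∣ q ∣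
∣p∪q∣≡∣p∣+∣q∣ []            []            _ = refl
∣p∪q∣≡∣p∣+∣q∣ (inside  ∷ p) (inside  ∷ q) d = contradiction here (d here)
∣p∪q∣≡∣p∣+∣q∣ (inside  ∷ p) (outside ∷ q) d =
  cong suc (∣p∪q∣≡∣p∣+∣q∣ p q λ x∈p x∈q → d (there x∈p) (there x∈q))
∣p∪q∣≡∣p∣+∣q∣ (outside ∷ p) (inside  ∷ q) d =
  trans (cong suc (∣p∪q∣≡∣p∣+∣q∣ p q λ x∈p x∈q → d (there x∈p) (there x∈q)))
        (sym (+-suc ∣ p ∣ ∣ q ∣))
∣p∪q∣≡∣p∣+∣q∣ (outside ∷ p) (outside ∷ q) d =
  ∣p∪q∣≡∣p∣+∣q∣ p q λ x∈p x∈q → d (there x∈p) (there x∈q)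

∣p-x∣+1≡∣p∣ : ∀ {p : Subset n} {x} → x ∈ p → suc ∣ p - x ∣ ≡ ∣ p ∣
∣p-x∣+1≡∣p∣ {p = inside ∷ p} here = cong suc (cong ∣_∣ (p─⊥≡p p))
∣p-x∣+1≡∣p∣ {p = inside  ∷ p} (there x∈p) = cong suc (∣p-x∣+1≡∣p∣ x∈p)
∣p-x∣+1≡∣p∣ {p = outside ∷ p} (there x∈p) = ∣p-x∣+1≡∣p∣ x∈p

x∈p─q⇒x∉q : ∀ {p q : Subset n} {x} → x ∈ p ─ q → x ∉ q
x∈p─q⇒x∉q {p = _ ∷ p} {inside  ∷ q} (there x∈) (there x∈q) = x∈p─q⇒x∉q x∈ x∈q
x∈p─q⇒x∉q {p = _ ∷ p} {outside ∷ q} (there x∈) (there x∈q) = x∈p─q⇒x∉q x∈ x∈q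
x∈p─q⇒x∉q {p = inside ∷ p} {outside ∷ q} here ()

0<∣p∣⇒Nonempty : ∀ (p : Subset n) → 0 < ∣ p ∣ → Nonempty p
0<∣p∣⇒Nonempty (inside  ∷ p) _ = zero , here
0<∣p∣⇒Nonempty (outside ∷ p) 0<∣p∣ with x , x∈p ← 0<∣p∣⇒Nonempty p 0<∣p∣ = suc x , there x∈p

Empty⇒∣p∣≡0 : ∀ {p : Subset n} → Empty p → ∣ p ∣ ≡ 0
Empty⇒∣p∣≡0 {n} ¬p = trans (cong ∣_∣ (Empty-unique ¬p)) (∣⊥∣≡0 n)

x∈p⇒⁅x⁆⊆p : ∀ {p : Subset n} {x} → x ∈ p → ⁅ x ⁆ ⊆ p
x∈p⇒⁅x⁆⊆p {x = x} x∈p y∈⁅x⁆ rewrite x∈⁅y⁆⇒x≡y x y∈⁅x⁆ = x∈p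

support : List (Fin n) → Subset n
support []       = ⊥
support (x ∷ xs) = ⁅ x ⁆ ∪ support xs

∈-support⁺ : ∀ {xs : List (Fin n)} {x} → x ∈ˡ xs → x ∈ support xs
∈-support⁺ {xs = x ∷ _} (here refl) = x∈p∪q⁺ (inj₁ (x∈⁅x⁆ x))
∈-support⁺ (there x∈xs) = x∈p∪q⁺ (inj₂ (∈-support⁺ x∈xs))

∈-support⁻ : ∀ {xs : List (Fin n)} {x} → x ∈ support xs → x ∈ˡ xs
∈-support⁻ {xs = []} x∈ = contradiction x∈ ∉⊥
∈-support⁻ {xs = y ∷ xs} x∈ with x∈p∪q⁻ ⁅ y ⁆ (support xs) x∈
... | inj₁ x∈⁅y⁆ = here (x∈⁅y⁆⇒x≡y y x∈⁅y⁆)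
... | inj₂ x∈xs = there (∈-support⁻ x∈xs)

∣support∣≤length : ∀ (xs : List (Fin n)) → ∣ support xs ∣ ≤ length xs
∣support∣≤length {n} []   = ≤-reflexive (∣⊥∣≡0 n)
∣support∣≤length (x ∷ xs) = ≤-trans (∣p∪q∣≤∣p∣+∣q∣ ⁅ x ⁆ (support xs))
                                    (+-mono-≤ (≤-reflexive (∣⁅x⁆∣≡1 x)) (∣support∣≤length xs))

-- Note that blocksThrough D q is, by definition, column D q.
column : ∀ {m} → (Fin m → Subset n) → Fin n → Subset m
column N j = tabulate λ i → lookup (N i) j

∈-column⁺ : ∀ {m} {N : Fin m → Subset n} {i j} → j ∈ N i → i ∈ column N j
∈-column⁺ {N = N} {i} {j} j∈Ni =
  lookup⇒[]= i (column N j) (trans (lookup∘tabulate (λ i → lookup (N i) j) i) ([]=⇒lookup j∈Ni))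

∈-column⁻ : ∀ {m} {N : Fin m → Subset n} {i j} → i ∈ column N j → j ∈ N i
∈-column⁻ {N = N} {i} {j} i∈ =
  lookup⇒[]= j (N i) (trans (sym (lookup∘tabulate (λ i → lookup (N i) j) i)) ([]=⇒lookup i∈))

indicator : Subset n → Fin n → ℕ
indicator p i = if lookup p i then 1 else 0

indicator-∈ : ∀ {p : Subset n} {i} → i ∈ p → indicator p i ≡ 1
indicator-∈ i∈p rewrite []=⇒lookup i∈p = refl

indicator-∉ : ∀ {p : Subset n} {i} → i ∉ p → indicator p i ≡ 0
indicator-∉ {p = p} {i} i∉p with lookup p i in eq
... | inside  = contradiction (lookup⇒[]= i p eq) i∉p
... | outside = refl

indicator≤1 : ∀ (p : Subset n) i → indicator p i ≤ 1
indicator≤1 p i with lookup p i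
... | inside  = ≤-refl
... | outside = z≤n

indicator-∩ : ∀ (p q : Subset n) i → indicator (p ∩ q) i ≡ indicator p i * indicator q i
indicator-∩ p q i rewrite lookup-zipWith _∧_ i p q with lookup p i | lookup q i
... | inside  | inside  = refl
... | inside  | outside = refl
... | outside | _       = refl

∣p∣≡∑indicator : ∀ (p : Subset n) → ∣ p ∣ ≡ ∑[ i < n ] indicator p i
∣p∣≡∑indicator []            = refl
∣p∣≡∑indicator (inside  ∷ p) = cong suc (∣p∣≡∑indicator p)
∣p∣≡∑indicator (outside ∷ p) = ∣p∣≡∑indicator p

∑-indicator : ∀ (p : Subset n) c → ∑[ i < n ] (indicator p i * c) ≡ ∣ p ∣ * c
∑-indicator p c = begin
  ∑[ i < _ ] (indicator p i * c)  ≡⟨ *-distribʳ-sum c (indicator p) ⟨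
  sum (indicator p) * c           ≡⟨ cong (_* c) (∣p∣≡∑indicator p) ⟨
  ∣ p ∣ * c                       ∎
  where open ≡-Reasoning

∑-mono-≤ : ∀ {f g : Fin n → ℕ} → (∀ i → f i ≤ g i) → sum f ≤ sum g
∑-mono-≤ {zero}  f≤g = z≤n
∑-mono-≤ {suc n} f≤g = +-mono-≤ (f≤g zero) (∑-mono-≤ (f≤g ∘ suc))

indicator-*-mono : ∀ {p : Subset n} {f g : Fin n → ℕ} → (∀ {i} → i ∈ p → f i ≤ g i) →
                   ∀ i → indicator p i * f i ≤ indicator p i * g i
indicator-*-mono {p = p} f≤g i with i ∈? p
... | yes i∈p rewrite indicator-∈ i∈p = *-monoʳ-≤ 1 (f≤g i∈p)
... | no  i∉p rewrite indicator-∉ i∉p = z≤n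

indicator-*-cong : ∀ {p : Subset n} {f g : Fin n → ℕ} → (∀ {i} → i ∈ p → f i ≡ g i) →
                   ∀ i → indicator p i * f i ≡ indicator p i * g i
indicator-*-cong f≡g i = ≤-antisym (indicator-*-mono (≤-reflexive ∘ f≡g) i)
                                    (indicator-*-mono (≤-reflexive ∘ sym ∘ f≡g) i)

∑-rows≡∑-columns : ∀ (N : Fin m → Subset n) (S : Subset m) →
  ∑[ i < m ] (indicator S i * ∣ N i ∣) ≡ ∑[ j < n ] ∣ S ∩ column N j ∣
∑-rows≡∑-columns {m} {n} N S = begin
  ∑[ i < m ] (indicator S i * ∣ N i ∣)
    ≡⟨ sum-cong-≗ (λ i → cong (indicator S i *_) (∣p∣≡∑indicator (N i))) ⟩
  ∑[ i < m ] (indicator S i * ∑[ j < n ] indicator (N i) j)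
    ≡⟨ sum-cong-≗ (λ i → *-distribˡ-sum (indicator S i) (indicator (N i))) ⟩
  ∑[ i < m ] ∑[ j < n ] (indicator S i * indicator (N i) j)
    ≡⟨ ∑-comm (λ i j → indicator S i * indicator (N i) j) ⟩
  ∑[ j < n ] ∑[ i < m ] (indicator S i * indicator (N i) j)
    ≡⟨ sum-cong-≗ (λ j → sum-cong-≗ (λ i → sym (entry i j))) ⟩
  ∑[ j < n ] ∑[ i < m ] indicator (S ∩ column N j) i
    ≡⟨ sum-cong-≗ (λ j → ∣p∣≡∑indicator (S ∩ column N j)) ⟨
  ∑[ j < n ] ∣ S ∩ column N j ∣ ∎
  where
  open ≡-Reasoning
  entry : ∀ i j → indicator (S ∩ column N j) i ≡ indicator S i * indicator (N i) j
  entry i j rewrite indicator-∩ S (column N j) i | lookup∘tabulate (λ i → lookup (N i) j) i = refl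

module _ (_≟ᴬ_ : DecidableEquality A) where

  unique⇒length≤ : ∀ {xs ys : List A} → Unique xs → (∀ {x} → x ∈ˡ xs → x ∈ˡ ys) →
                   length xs ≤ length ys
  unique⇒length≤ {[]}     _             _     = z≤n
  unique⇒length≤ {x ∷ xs} {ys} (x∉xs ∷ xs!) xs⊆ys =
    ≤-trans (s≤s (unique⇒length≤ xs! xs⊆ys∖x))
            (filter-notAll (¬? ∘ (x ≟ᴬ_)) ys (lose (xs⊆ys (here refl)) λ x≢x → x≢x refl))
    where
    xs⊆ys∖x : ∀ {z} → z ∈ˡ xs → z ∈ˡ filter (¬? ∘ (x ≟ᴬ_)) ys
    xs⊆ys∖x z∈xs = ∈-filter⁺ (¬? ∘ (x ≟ᴬ_)) (xs⊆ys (there z∈xs)) (All.lookup x∉xs z∈xs)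

module _ (f : A → Maybe B) where

  ∈-mapMaybe⁺ : ∀ {xs x y} → x ∈ˡ xs → f x ≡ just y → y ∈ˡ mapMaybe f xs
  ∈-mapMaybe⁺ {x ∷ xs} (here refl) fx≡y rewrite fx≡y = here refl
  ∈-mapMaybe⁺ {x′ ∷ xs} (there x∈xs) fx≡y with f x′
  ... | just _  = there (∈-mapMaybe⁺ x∈xs fx≡y)
  ... | nothing = ∈-mapMaybe⁺ x∈xs fx≡y

  ∈-mapMaybe⁻ : ∀ {xs y} → y ∈ˡ mapMaybe f xs → ∃ λ x → x ∈ˡ xs × f x ≡ just y
  ∈-mapMaybe⁻ {x ∷ xs} y∈ with f x in fx≡
  ∈-mapMaybe⁻ {x ∷ xs} (here refl) | just _ = x , here refl , fx≡
  ∈-mapMaybe⁻ {x ∷ xs} (there y∈) | just _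
    with x′ , x′∈ , fx′≡ ← ∈-mapMaybe⁻ y∈ = x′ , there x′∈ , fx′≡
  ∈-mapMaybe⁻ {x ∷ xs} y∈ | nothing
    with x′ , x′∈ , fx′≡ ← ∈-mapMaybe⁻ y∈ = x′ , there x′∈ , fx′≡

  mapMaybe⁺ : (∀ {x x′ y} → f x ≡ just y → f x′ ≡ just y → x ≡ x′) →
              ∀ {xs} → Unique xs → Unique (mapMaybe f xs)
  mapMaybe⁺ f-inj {[]}     _ = []
  mapMaybe⁺ f-inj {x ∷ xs} (x∉xs ∷ xs!) with f x in fx≡
  ... | nothing = mapMaybe⁺ f-inj xs!
  ... | just y  = All.tabulate y∉ ∷ mapMaybe⁺ f-inj xs!
    where
    y∉ : ∀ {y′} → y′ ∈ˡ mapMaybe f xs → y ≢ y′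
    y∉ y′∈ refl with x′ , x′∈ , fx′≡ ← ∈-mapMaybe⁻ y′∈ =
      All.lookup x∉xs x′∈ (f-inj fx≡ fx′≡)

  length-mapMaybe-< : ∀ {xs x} → x ∈ˡ xs → f x ≡ nothing → length (mapMaybe f xs) < length xs
  length-mapMaybe-< {x ∷ xs} (here refl) fx≡ rewrite fx≡ = s≤s (length-mapMaybe f xs)
  length-mapMaybe-< {x′ ∷ xs} (there x∈xs) fx≡ with f x′
  ... | just _  = s≤s (length-mapMaybe-< x∈xs fx≡)
  ... | nothing = m≤n⇒m≤1+n (length-mapMaybe-< x∈xs fx≡)

-- Hall's theorem

neighbourhood : (Fin m → Subset n) → Subset m → Subset n
neighbourhood N []            = ⊥
neighbourhood N (inside  ∷ S) = N zero ∪ neighbourhood (N ∘ suc) S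
neighbourhood N (outside ∷ S) = neighbourhood (N ∘ suc) S

∈-neighbourhood⁺ : ∀ {N : Fin m → Subset n} {S i j} → i ∈ S → j ∈ N i → j ∈ neighbourhood N S
∈-neighbourhood⁺ {S = inside  ∷ S} here        j∈Ni = x∈p∪q⁺ (inj₁ j∈Ni)
∈-neighbourhood⁺ {S = inside  ∷ S} (there i∈S) j∈Ni = x∈p∪q⁺ (inj₂ (∈-neighbourhood⁺ i∈S j∈Ni))
∈-neighbourhood⁺ {S = outside ∷ S} (there i∈S) j∈Ni = ∈-neighbourhood⁺ i∈S j∈Ni

∈-neighbourhood⁻ : ∀ {N : Fin m → Subset n} {S j} →
                   j ∈ neighbourhood N S → ∃ λ i → i ∈ S × j ∈ N i
∈-neighbourhood⁻ {S = []} j∈ = contradiction j∈ ∉⊥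
∈-neighbourhood⁻ {N = N} {S = inside ∷ S} j∈ with x∈p∪q⁻ (N zero) _ j∈
... | inj₁ j∈N₀ = zero , here , j∈N₀
... | inj₂ j∈′ with i , i∈S , j∈Ni ← ∈-neighbourhood⁻ {N = N ∘ suc} j∈′ = suc i , there i∈S , j∈Ni
∈-neighbourhood⁻ {N = N} {S = outside ∷ S} j∈
  with i , i∈S , j∈Ni ← ∈-neighbourhood⁻ {N = N ∘ suc} j∈ = suc i , there i∈S , j∈Ni

HallCondition : (Fin m → Subset n) → Subset m → Set
HallCondition N L = ∀ S → S ⊆ L → ∣ S ∣ ≤ ∣ neighbourhood N S ∣

-- A matching of L into N is recorded by its inverse, so that distinct
-- elements of L automatically get distinct partners.
record Matching (N : Fin m → Subset n) (L : Subset m) : Set where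
  field
    partnerOf          : Fin n → Maybe (Fin m)
    partnerOf-adjacent : ∀ {i j} → partnerOf j ≡ just i → j ∈ N i
    partnerOf-covers   : ∀ {i} → i ∈ L → ∃ λ j → partnerOf j ≡ just i

module _ {N : Fin m → Subset n} where

  emptyMatching : ∀ {L} → Empty L → Matching N L
  emptyMatching ¬L = record
    { partnerOf          = λ _ → nothing
    ; partnerOf-adjacent = λ ()
    ; partnerOf-covers   = λ i∈L → contradiction (_ , i∈L) ¬L
    }

  extendMatching : ∀ {L x y} → x ∈ L → y ∈ N x →
                   Matching (λ i → N i - y) (L - x) → Matching N L
  extendMatching {L} {x} {y} x∈L y∈Nx M = record
    { partnerOf          = partnerOf
    ; partnerOf-adjacent = adjacent
    ; partnerOf-covers   = covers
    }
    where
    module M = Matching M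
    partnerOf : Fin n → Maybe (Fin m)
    partnerOf j with j ≟ y
    ... | yes _ = just x
    ... | no  _ = M.partnerOf j
    adjacent : ∀ {i j} → partnerOf j ≡ just i → j ∈ N i
    adjacent {i} {j} eq with j ≟ y
    ... | yes refl with refl ← just-injective eq = y∈Nx
    ... | no  _    = p─q⊆p _ _ (M.partnerOf-adjacent eq)
    covers : ∀ {i} → i ∈ L → ∃ λ j → partnerOf j ≡ just i
    covers {i} i∈L with i ≟ x
    ... | yes refl = y , matchY
      where
      matchY : partnerOf y ≡ just i
      matchY with y ≟ y
      ... | yes _   = refl
      ... | no  y≢y = contradiction refl y≢y
    ... | no  i≢x with j , eq ← M.partnerOf-covers (x∈p∧x≢y⇒x∈p-y i∈L i≢x) = j , matchJ
      where
      j≢y : j ≢ y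
      j≢y refl = x∈p─q⇒x∉q (M.partnerOf-adjacent eq) (x∈⁅x⁆ y)
      matchJ : partnerOf j ≡ just i
      matchJ with j ≟ y
      ... | yes j≡y = contradiction j≡y j≢y
      ... | no  _   = eq

  unionMatching : ∀ {L S} → Matching N S →
                  Matching (λ i → N i ─ neighbourhood N S) (L ─ S) → Matching N L
  unionMatching {L} {S} MS MR = record
    { partnerOf          = partnerOf
    ; partnerOf-adjacent = adjacent
    ; partnerOf-covers   = covers
    }
    where
    module MS = Matching MS
    module MR = Matching MR
    partnerOf : Fin n → Maybe (Fin m)
    partnerOf j with j ∈? neighbourhood N S
    ... | yes _ = MS.partnerOf j
    ... | no  _ = MR.partnerOf j
    adjacent : ∀ {i j} → partnerOf j ≡ just i → j ∈ N i
    adjacent {i} {j} eq with j ∈? neighbourhood N S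
    ... | yes _ = MS.partnerOf-adjacent eq
    ... | no  _ = p─q⊆p _ _ (MR.partnerOf-adjacent eq)
    covers : ∀ {i} → i ∈ L → ∃ λ j → partnerOf j ≡ just i
    covers {i} i∈L with i ∈? S
    ... | yes i∈S with j , eq ← MS.partnerOf-covers i∈S = j , matchJ
      where
      matchJ : partnerOf j ≡ just i
      matchJ with j ∈? neighbourhood N S
      ... | yes _   = eq
      ... | no  j∉ = contradiction (∈-neighbourhood⁺ i∈S (MS.partnerOf-adjacent eq)) j∉
    covers {i} i∈L | no i∉S with j , eq ← MR.partnerOf-covers (x∈p∧x∉q⇒x∈p─q i∈L i∉S) = j , matchJ
      where
      matchJ : partnerOf j ≡ just i
      matchJ with j ∈? neighbourhood N S
      ... | yes j∈ = contradiction j∈ (x∈p─q⇒x∉q (MR.partnerOf-adjacent eq))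
      ... | no  _  = eq


module _ {N : Fin m → Subset n} {L : Subset m} (hallL : HallCondition N L) where

  hallCondition⇒adjacent : ∀ {x} → x ∈ L → ∃ λ y → y ∈ N x
  hallCondition⇒adjacent {x} x∈L
    with y , y∈ ← 0<∣p∣⇒Nonempty (neighbourhood N ⁅ x ⁆)
                    (subst (_≤ ∣ neighbourhood N ⁅ x ⁆ ∣) (∣⁅x⁆∣≡1 x) (hallL ⁅ x ⁆ (x∈p⇒⁅x⁆⊆p x∈L)))
    with i , i∈⁅x⁆ , y∈Ni ← ∈-neighbourhood⁻ {N = N} {S = ⁅ x ⁆} y∈
    rewrite x∈⁅y⁆⇒x≡y x i∈⁅x⁆ = y , y∈Ni

  hallCondition-─ : ∀ {S} → S ⊆ L → ∣ neighbourhood N S ∣ ≤ ∣ S ∣ →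
                    HallCondition (λ i → N i ─ neighbourhood N S) (L ─ S)
  hallCondition-─ {S} S⊆L tight U U⊆L─S = +-cancelʳ-≤ (∣ S ∣) (∣ U ∣) (∣ NU ∣) (begin
    ∣ U ∣ + ∣ S ∣                ≡⟨ ∣p∪q∣≡∣p∣+∣q∣ U S (x∈p─q⇒x∉q ∘ U⊆L─S) ⟨
    ∣ U ∪ S ∣                    ≤⟨ hallL (U ∪ S) U∪S⊆L ⟩
    ∣ neighbourhood N (U ∪ S) ∣  ≤⟨ p⊆q⇒∣p∣≤∣q∣ split ⟩
    ∣ NU ∪ NS ∣                  ≤⟨ ∣p∪q∣≤∣p∣+∣q∣ NU NS ⟩
    ∣ NU ∣ + ∣ NS ∣              ≤⟨ +-monoʳ-≤ ∣ NU ∣ tight ⟩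
    ∣ NU ∣ + ∣ S ∣               ∎)
    where
    open ≤-Reasoning
    NS NU : Subset n
    NS = neighbourhood N S
    NU = neighbourhood (λ i → N i ─ NS) U
    U∪S⊆L : U ∪ S ⊆ L
    U∪S⊆L x∈ with x∈p∪q⁻ U S x∈
    ... | inj₁ x∈U = p─q⊆p L S (U⊆L─S x∈U)
    ... | inj₂ x∈S = S⊆L x∈S
    split : neighbourhood N (U ∪ S) ⊆ NU ∪ NS
    split {j} j∈ with i , i∈U∪S , j∈Ni ← ∈-neighbourhood⁻ j∈ | j ∈? NS
    ... | yes j∈NS = x∈p∪q⁺ (inj₂ j∈NS)
    ... | no  j∉NS with x∈p∪q⁻ U S i∈U∪S
    ...   | inj₁ i∈U = x∈p∪q⁺ (inj₁ (∈-neighbourhood⁺ i∈U (x∈p∧x∉q⇒x∈p─q j∈Ni j∉NS)))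
    ...   | inj₂ i∈S = contradiction (∈-neighbourhood⁺ i∈S j∈Ni) j∉NS

∣neighbourhood∣≤1+∣neighbourhood-y∣ : ∀ (N : Fin m → Subset n) S y →
  ∣ neighbourhood N S ∣ ≤ suc ∣ neighbourhood (λ i → N i - y) S ∣
∣neighbourhood∣≤1+∣neighbourhood-y∣ {m} {n} N S y = begin
  ∣ neighbourhood N S ∣                ≤⟨ p⊆q⇒∣p∣≤∣q∣ cover ⟩
  ∣ ⁅ y ⁆ ∪ neighbourhood N′ S ∣       ≤⟨ ∣p∪q∣≤∣p∣+∣q∣ ⁅ y ⁆ (neighbourhood N′ S) ⟩
  ∣ ⁅ y ⁆ ∣ + ∣ neighbourhood N′ S ∣   ≡⟨ cong (_+ ∣ neighbourhood N′ S ∣) (∣⁅x⁆∣≡1 y) ⟩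
  suc ∣ neighbourhood N′ S ∣           ∎
  where
  open ≤-Reasoning
  N′ : Fin m → Subset n
  N′ i = N i - y
  cover : neighbourhood N S ⊆ ⁅ y ⁆ ∪ neighbourhood N′ S
  cover {j} j∈ with i , i∈S , j∈Ni ← ∈-neighbourhood⁻ {N = N} {S = S} j∈ | j ≟ y
  ... | yes refl = x∈p∪q⁺ (inj₁ (x∈⁅x⁆ y))
  ... | no  j≢y  = x∈p∪q⁺ (inj₂ (∈-neighbourhood⁺ {N = N′} i∈S (x∈p∧x≢y⇒x∈p-y j∈Ni j≢y)))

-- Either removing some x ∈ L and
-- a neighbour y of it keeps Hall's condition, or some S ⊆ L - x is deficient
-- once y is deleted; then S is tight, and L splits into S and L ─ S.
hall-≤ : ∀ k (N : Fin m → Subset n) L → ∣ L ∣ ≤ k → HallCondition N L → Matching N L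
hall-≤ k N L ∣L∣≤k hallL with nonempty? L
... | no ¬L = emptyMatching ¬L
hall-≤ zero N L ∣L∣≤0 hallL | yes (x , x∈L) =
  contradiction (≤-trans (x∈p⇒∣p-x∣<∣p∣ x∈L) ∣L∣≤0) λ ()
hall-≤ (suc k) N L ∣L∣≤1+k hallL | yes (x , x∈L)
  with y , y∈Nx ← hallCondition⇒adjacent hallL x∈L
  with anySubset? (λ S → S ⊆? (L - x) ×-dec ∣ neighbourhood (λ i → N i - y) S ∣ <? ∣ S ∣)
... | no noDeficient =
  extendMatching x∈L y∈Nx
    (hall-≤ k _ (L - x) ∣L-x∣≤k λ S S⊆ → ≮⇒≥ λ lt → noDeficient (S , S⊆ , lt))
  where
  ∣L-x∣≤k : ∣ L - x ∣ ≤ k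
  ∣L-x∣≤k = ≤-pred (≤-trans (x∈p⇒∣p-x∣<∣p∣ x∈L) ∣L∣≤1+k)
... | yes (S , S⊆L-x , deficient) =
  unionMatching (hall-≤ k N S ∣S∣≤k (λ U U⊆S → hallL U (⊆-trans U⊆S S⊆L)))
                (hall-≤ k _ (L ─ S) ∣L─S∣≤k (hallCondition-─ hallL S⊆L tight))
  where
  S⊆L : S ⊆ L
  S⊆L = p─q⊆p L ⁅ x ⁆ ∘ S⊆L-x
  tight : ∣ neighbourhood N S ∣ ≤ ∣ S ∣
  tight = ≤-trans (∣neighbourhood∣≤1+∣neighbourhood-y∣ N S y) deficient
  ∣S∣≤k : ∣ S ∣ ≤ k
  ∣S∣≤k = ≤-pred (≤-trans (s≤s (p⊆q⇒∣p∣≤∣q∣ S⊆L-x))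
                          (≤-trans (x∈p⇒∣p-x∣<∣p∣ x∈L) ∣L∣≤1+k))
  ∣L─S∣≤k : ∣ L ─ S ∣ ≤ k
  ∣L─S∣≤k with z , z∈S ← 0<∣p∣⇒Nonempty S (≤-trans (s≤s z≤n) deficient) =
    ≤-pred (≤-trans (p∩q≢∅⇒∣p─q∣<∣p∣ L S (z , x∈p∩q⁺ (S⊆L z∈S , z∈S))) ∣L∣≤1+k)

hall : ∀ (N : Fin m → Subset n) L → HallCondition N L → Matching N L
hall N L = hall-≤ ∣ L ∣ N L ≤-refl

-- ∣ S ∣ c ≤ (number of edges between S and its neighbourhood) ≤ ∣ N S ∣ d.
hallCondition-byDegrees : ∀ {N : Fin m → Subset n} {L c d} .{{_ : NonZero c}} → d ≤ c →
  (∀ {i} → i ∈ L → c ≤ ∣ N i ∣) → (∀ j → ∣ L ∩ column N j ∣ ≤ d) → HallCondition N L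
hallCondition-byDegrees {m} {n} {N} {L} {c} {d} d≤c rowDegree columnDegree S S⊆L =
  *-cancelʳ-≤ (∣ S ∣) (∣ NS ∣) c (begin
    ∣ S ∣ * c                              ≡⟨ ∑-indicator S c ⟨
    ∑[ i < m ] (indicator S i * c)         ≤⟨ ∑-mono-≤ (indicator-*-mono (rowDegree ∘ S⊆L)) ⟩
    ∑[ i < m ] (indicator S i * ∣ N i ∣)   ≡⟨ ∑-rows≡∑-columns N S ⟩
    ∑[ j < n ] ∣ S ∩ column N j ∣          ≤⟨ ∑-mono-≤ columnBound ⟩
    ∑[ j < n ] (indicator NS j * d)        ≡⟨ ∑-indicator NS d ⟩
    ∣ NS ∣ * d                             ≤⟨ *-monoʳ-≤ (∣ NS ∣) d≤c ⟩
    ∣ NS ∣ * c                             ∎)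
  where
  open ≤-Reasoning
  NS : Subset n
  NS = neighbourhood N S
  columnBound : ∀ j → ∣ S ∩ column N j ∣ ≤ indicator NS j * d
  columnBound j with j ∈? NS
  ... | yes j∈NS rewrite indicator-∈ j∈NS | +-identityʳ d =
    ≤-trans (p⊆q⇒∣p∣≤∣q∣ λ {i} i∈ →
               let i∈S , i∈col = x∈p∩q⁻ S _ i∈ in x∈p∩q⁺ (S⊆L i∈S , i∈col))
            (columnDegree j)
  ... | no  j∉NS rewrite indicator-∉ j∉NS = ≤-reflexive (Empty⇒∣p∣≡0 λ (i , i∈) →
    let i∈S , i∈col = x∈p∩q⁻ S _ i∈ in j∉NS (∈-neighbourhood⁺ i∈S (∈-column⁻ {N = N} i∈col)))

-- Edge dominating sets

module _ {v b} (D : IncStr v b) where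

  BlockChoice : Set
  BlockChoice = (q : Fin v) → Maybe (∃ λ B → q ∈ D B)

  chosenBlock : BlockChoice → Fin v → Maybe (Fin b)
  chosenBlock σ q = Maybe.map proj₁ (σ q)

  chosenEdge : BlockChoice → Fin v → Maybe (Fin v × Fin b)
  chosenEdge σ q = Maybe.map (q ,_) (chosenBlock σ q)

  chosenEdges : BlockChoice → List (Fin v × Fin b)
  chosenEdges σ = mapMaybe (chosenEdge σ) (allFin v)

  Covering : BlockChoice → Set
  Covering σ = ∀ {x C} → x ∈ D C →
    (∃ λ B → chosenBlock σ x ≡ just B) ⊎ (∃ λ q → chosenBlock σ q ≡ just C)

  module _ (σ : BlockChoice) where

    chosenEdge-isEdge : ∀ {q e} → chosenEdge σ q ≡ just e → IsEdge D e
    chosenEdge-isEdge {q} eq with σ q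
    chosenEdge-isEdge refl | just (B , q∈B) = q∈B

    chosenEdge-point : ∀ {q e} → chosenEdge σ q ≡ just e → q ≡ proj₁ e
    chosenEdge-point {q} eq with σ q
    chosenEdge-point refl | just _ = refl

    ∈-chosenEdges : ∀ {q B} → chosenBlock σ q ≡ just B → (q , B) ∈ˡ chosenEdges σ
    ∈-chosenEdges {q} eq = ∈-mapMaybe⁺ (chosenEdge σ) (∈-allFin q) (cong (Maybe.map (q ,_)) eq)

    chosenEdgeDomSet : Covering σ → EdgeDomSet D
    chosenEdgeDomSet dom = record
      { edges     = chosenEdges σ
      ; areEdges  = All.tabulate λ e∈ →
          let _ , _ , eq = ∈-mapMaybe⁻ (chosenEdge σ) {xs = allFin v} e∈ in chosenEdge-isEdge eq
      ; distinct  = mapMaybe⁺ (chosenEdge σ)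
          (λ eq eq′ → trans (chosenEdge-point eq) (sym (chosenEdge-point eq′))) (Unique.allFin⁺ v)
      ; dominates = dominates
      }
      where
      dominates : ∀ e → IsEdge D e → Any (ShareVertex e) (chosenEdges σ)
      dominates (x , C) x∈C with dom {x} {C} x∈C
      ... | inj₁ (B , eq) = lose (∈-chosenEdges eq) (inj₁ refl)
      ... | inj₂ (q , eq) = lose (∈-chosenEdges eq) (inj₂ refl)

    size-chosenEdgeDomSet : ∀ (dom : Covering σ) → size (chosenEdgeDomSet dom) ≤ v
    size-chosenEdgeDomSet _ =
      ≤-trans (length-mapMaybe (chosenEdge σ) (allFin v)) (≤-reflexive (length-tabulate _))

    size-chosenEdgeDomSet-< : ∀ (dom : Covering σ) {p} → σ p ≡ nothing → size (chosenEdgeDomSet dom) < v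
    size-chosenEdgeDomSet-< _ {p} σp≡ =
      ≤-trans (length-mapMaybe-< (chosenEdge σ) (∈-allFin p) eq) (≤-reflexive (length-tabulate _))
      where
      eq : chosenEdge σ p ≡ nothing
      eq rewrite σp≡ = refl

  firstBlock : BlockChoice
  firstBlock q = dec⇒maybe (any? λ B → q ∈? D B)

  firstBlock-chosen : ∀ {x C} → x ∈ D C → ∃ λ B → chosenBlock firstBlock x ≡ just B
  firstBlock-chosen {x} {C} x∈C with any? (λ B → x ∈? D B)
  ... | yes (B , _) = B , refl
  ... | no  ∄B      = contradiction (C , x∈C) ∄B

  firstBlock-covering : Covering firstBlock
  firstBlock-covering = inj₁ ∘ firstBlock-chosen

  pointwiseEdgeDomSet : ∃ λ (Γ : EdgeDomSet D) → size Γ ≤ v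
  pointwiseEdgeDomSet = chosenEdgeDomSet firstBlock firstBlock-covering ,
                        size-chosenEdgeDomSet firstBlock firstBlock-covering

  module _ (Γ : EdgeDomSet D) where
    open EdgeDomSet Γ
    open ≤-Reasoning

    size-lowerBound : v ≤ size Γ ⊎ ∃ λ q → ∣ blocksThrough D q ∣ ≤ size Γ
    size-lowerBound with all? (_∈? support (map proj₁ edges))
    ... | yes all∈ = inj₁ (begin
      v                               ≡⟨ ∣⊤∣≡n v ⟨
      ∣ ⊤ {v} ∣                       ≤⟨ p⊆q⇒∣p∣≤∣q∣ {p = ⊤} (λ {q} _ → all∈ q) ⟩
      ∣ support (map proj₁ edges) ∣   ≤⟨ ∣support∣≤length (map proj₁ edges) ⟩
      length (map proj₁ edges)        ≡⟨ length-map proj₁ edges ⟩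
      size Γ                          ∎)
    ... | no ¬all with q , q∉points ← ¬∀⟶∃¬ v _ (_∈? support (map proj₁ edges)) ¬all =
      inj₂ (q , (begin
        ∣ blocksThrough D q ∣          ≤⟨ p⊆q⇒∣p∣≤∣q∣ pencil⊆blocks ⟩
        ∣ support (map proj₂ edges) ∣  ≤⟨ ∣support∣≤length (map proj₂ edges) ⟩
        length (map proj₂ edges)       ≡⟨ length-map proj₂ edges ⟩
        size Γ                         ∎))
      where
      pencil⊆blocks : blocksThrough D q ⊆ support (map proj₂ edges)
      pencil⊆blocks {B} B∈ with find (dominates (q , B) (∈-column⁻ {N = D} B∈))
      ... | _ , e∈ , inj₁ refl = contradiction (∈-support⁺ (∈-map⁺ proj₁ e∈)) q∉points
      ... | _ , e∈ , inj₂ refl = ∈-support⁺ (∈-map⁺ proj₂ e∈)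

module _ {P : ℕ → Set} (P? : Decidable P) (P-mono : ∀ {m n} → m ≤ n → P m → P n) where

  least : ∀ n → P n → ∃ λ k → P k × (∀ {j} → P j → k ≤ j)
  least zero    p₀ = zero , p₀ , λ _ → z≤n
  least (suc n) pₙ₊₁ with P? n
  ... | yes pₙ = least n pₙ
  ... | no ¬pₙ = suc n , pₙ₊₁ , λ pⱼ → ≰⇒> λ j≤n → ¬pₙ (P-mono j≤n pⱼ)

module _ {v b} (D : IncStr v b) where

  private
    pairs : List (Fin v × Fin b)
    pairs = cartesianProduct (allFin v) (allFin b)

    index : Fin v × Fin b → Fin (v * b)
    index = uncurry combine

    index-injective : ∀ {e e′} → index e ≡ index e′ → e ≡ e′
    index-injective {q , B} {q′ , B′} eq =
      trans (sym (remQuot-combine q B)) (trans (cong (remQuot b) eq) (remQuot-combine q′ B′))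

  -- Edge sets of I(D) are encoded as subsets of Fin (v * b), which makes
  -- the existence of a small edge dominating set decidable.
  edgesIn : Subset (v * b) → List (Fin v × Fin b)
  edgesIn M = filter (λ e → index e ∈? M) pairs

  edgesIn-unique : ∀ M → Unique (edgesIn M)
  edgesIn-unique M = Unique.filter⁺ _ (Unique.cartesianProduct⁺ (Unique.allFin⁺ v) (Unique.allFin⁺ b))

  Dominates : List (Fin v × Fin b) → Set
  Dominates es = ∀ e → IsEdge D e → Any (ShareVertex e) es

  dominates? : ∀ es → Dec (Dominates es)
  dominates? es = map′ (λ h (q , B) → h q B) (λ h q B → h (q , B))
    (all? λ q → all? λ B → (q ∈? D B) →-dec Any.any? (shareVertex? (q , B)) es)
    where
    shareVertex? : ∀ e e′ → Dec (ShareVertex e e′)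
    shareVertex? (q , B) (q′ , B′) = (q ≟ q′) ⊎-dec (B ≟ B′)

  SmallEdgeDomCode : ℕ → Set
  SmallEdgeDomCode n = ∃ λ M → (All (IsEdge D) (edgesIn M) × Dominates (edgesIn M)) × length (edgesIn M) ≤ n

  smallEdgeDomCode? : Decidable SmallEdgeDomCode
  smallEdgeDomCode? n = anySubset? λ M →
    (All.all? (λ (q , B) → q ∈? D B) (edgesIn M) ×-dec dominates? (edgesIn M)) ×-dec (length (edgesIn M) ≤? n)

  decode : ∀ {n} → SmallEdgeDomCode n → ∃ λ (Γ : EdgeDomSet D) → size Γ ≤ n
  decode (M , (areEdges , dominates) , length≤n) = record
    { edges     = edgesIn M
    ; areEdges  = areEdges
    ; distinct  = edgesIn-unique M
    ; dominates = dominates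
    } , length≤n

  encode : ∀ (Γ : EdgeDomSet D) → SmallEdgeDomCode (size Γ)
  encode Γ = M , (All.tabulate (All.lookup areEdges ∘ ⊆edges) , dominatesM) ,
             unique⇒length≤ (≡-dec _≟_ _≟_) (edgesIn-unique M) ⊆edges
    where
    open EdgeDomSet Γ
    M : Subset (v * b)
    M = support (map index edges)
    ⊆edges : ∀ {e} → e ∈ˡ edgesIn M → e ∈ˡ edges
    ⊆edges e∈ with _ , index∈ ← ∈-filter⁻ (λ e → index e ∈? M) {xs = pairs} e∈
               with _ , e′∈ , eq ← ∈-map⁻ index (∈-support⁻ index∈)
               rewrite index-injective eq = e′∈
    edges⊆ : ∀ {e} → e ∈ˡ edges → e ∈ˡ edgesIn M
    edges⊆ {q , B} e∈ = ∈-filter⁺ (λ e → index e ∈? M) (∈-cartesianProduct⁺ (∈-allFin q) (∈-allFin B))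
                                   (∈-support⁺ (∈-map⁺ index e∈))
    dominatesM : Dominates (edgesIn M)
    dominatesM e e-edge with _ , e′∈ , share ← find (dominates e e-edge) = lose (edges⊆ e′∈) share

  edgeDomNumber : ∀ (Γ : EdgeDomSet D) → ∃ λ n → IsEdgeDomNumber D n × n ≤ size Γ
  edgeDomNumber Γ
    with n , code , minimal ← least smallEdgeDomCode? (λ m≤n (M , valid , ≤m) → M , valid , ≤-trans ≤m m≤n)
                                    (size Γ) (encode Γ)
    with Γₙ , size≤n ← decode code
    = n , ((Γₙ , ≤-antisym size≤n (minimal (encode Γₙ))) , minimal ∘ encode) , minimal (encode Γ)

-- Designs

edgeDomSet-size≥ : ∀ {v b k r lam} {D : IncStr v b} → IsDesign D k r lam →
                   v ≤ r → ∀ (Γ : EdgeDomSet D) → v ≤ size Γ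
edgeDomSet-size≥ {D = D} design v≤r Γ with size-lowerBound D Γ
... | inj₁ v≤size              = v≤size
... | inj₂ (q , pencil≤size) =
  ≤-trans v≤r (≤-trans (≤-reflexive (sym (IsDesign.replication design q))) pencil≤size)

module Pencil {v′ b k r lam} {D : IncStr (suc v′) b} (design : IsDesign D k r lam)
              (p : Fin (suc v′)) where
  open IsDesign design

  pencil : Subset b
  pencil = blocksThrough D p

  residual : Fin b → Subset (suc v′)
  residual B = D B - p

  ∣residual∣ : ∀ {B} → B ∈ pencil → ∣ residual B ∣ ≡ k ∸ 1
  ∣residual∣ {B} B∈pencil =
    cong (_∸ 1) (trans (∣p-x∣+1≡∣p∣ (∈-column⁻ {N = D} B∈pencil)) (blockSize B))

  pencil∩column≡blocksThrough₂ : ∀ {q} → q ≢ p → pencil ∩ column residual q ≡ blocksThrough₂ D p q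
  pencil∩column≡blocksThrough₂ {q} q≢p = ⊆-antisym ⊆blocksThrough₂ blocksThrough₂⊆
    where
    ⊆blocksThrough₂ : pencil ∩ column residual q ⊆ blocksThrough₂ D p q
    ⊆blocksThrough₂ {B} B∈ with B∈pencil , B∈column ← x∈p∩q⁻ pencil _ B∈ =
      lookup⇒[]= B _ (trans (lookup∘tabulate _ B)
        (cong₂ _∧_ ([]=⇒lookup (∈-column⁻ {N = D} B∈pencil))
                   ([]=⇒lookup (p─q⊆p (D B) ⁅ p ⁆ (∈-column⁻ {N = residual} B∈column)))))
    blocksThrough₂⊆ : blocksThrough₂ D p q ⊆ pencil ∩ column residual q
    blocksThrough₂⊆ {B} B∈ = x∈p∩q⁺
      ( ∈-column⁺ {N = D} (lookup⇒[]= p (D B) (∧-conicalˡ _ _ both))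
      , ∈-column⁺ {N = residual} (x∈p∧x≢y⇒x∈p-y (lookup⇒[]= q (D B) (∧-conicalʳ _ _ both)) q≢p))
      where
      both : lookup (D B) p ∧ lookup (D B) q ≡ inside
      both = trans (sym (lookup∘tabulate _ B)) ([]=⇒lookup B∈)

  ∣pencil∩column∣ : ∀ q → ∣ pencil ∩ column residual q ∣ ≡ indicator (⊤ - p) q * lam
  ∣pencil∩column∣ q with q ≟ p
  ... | yes refl rewrite indicator-∉ {p = ⊤ - q} (λ q∈ → x∈p─q⇒x∉q q∈ (x∈⁅x⁆ q)) =
    Empty⇒∣p∣≡0 λ (B , B∈) → x∈p─q⇒x∉q (∈-column⁻ {N = residual} (proj₂ (x∈p∩q⁻ pencil _ B∈))) (x∈⁅x⁆ q)
  ... | no  q≢p rewrite indicator-∈ (x∈p∧x≢y⇒x∈p-y ∈⊤ q≢p) | +-identityʳ lam =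
    trans (cong ∣_∣ (pencil∩column≡blocksThrough₂ q≢p)) (balanced p q (q≢p ∘ sym))

  ∣⊤-p∣≡v′ : ∣ ⊤ - p ∣ ≡ v′
  ∣⊤-p∣≡v′ = suc-injective (trans (∣p-x∣+1≡∣p∣ {p = ⊤} {x = p} ∈⊤) (∣⊤∣≡n (suc v′)))

  r*[k∸1]≡v′*lam : r * (k ∸ 1) ≡ v′ * lam
  r*[k∸1]≡v′*lam = begin
    r * (k ∸ 1)                                       ≡⟨ cong (_* (k ∸ 1)) (replication p) ⟨
    ∣ pencil ∣ * (k ∸ 1)                              ≡⟨ ∑-indicator pencil (k ∸ 1) ⟨
    ∑[ B < b ] (indicator pencil B * (k ∸ 1))         ≡⟨ sum-cong-≗ (indicator-*-cong (sym ∘ ∣residual∣)) ⟩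
    ∑[ B < b ] (indicator pencil B * ∣ residual B ∣)  ≡⟨ ∑-rows≡∑-columns residual pencil ⟩
    ∑[ q < suc v′ ] ∣ pencil ∩ column residual q ∣    ≡⟨ sum-cong-≗ ∣pencil∩column∣ ⟩
    ∑[ q < suc v′ ] (indicator (⊤ - p) q * lam)       ≡⟨ ∑-indicator (⊤ - p) lam ⟩
    ∣ ⊤ - p ∣ * lam                                   ≡⟨ cong (_* lam) ∣⊤-p∣≡v′ ⟩
    v′ * lam                                          ∎
    where open ≡-Reasoning

  lam≤k∸1 : 0 < r → r ≤ v′ → lam ≤ k ∸ 1
  lam≤k∸1 0<r r≤v′ = *-cancelˡ-≤ v′ {{>-nonZero (≤-trans 0<r r≤v′)}} (begin
    v′ * lam      ≡⟨ r*[k∸1]≡v′*lam ⟨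
    r * (k ∸ 1)   ≤⟨ *-monoˡ-≤ (k ∸ 1) r≤v′ ⟩
    v′ * (k ∸ 1)  ∎)
    where open ≤-Reasoning

  hallCondition-pencil : r ≤ v′ → HallCondition residual pencil
  hallCondition-pencil r≤v′ S S⊆pencil with 0 <? r
  ... | no  r≯0 = ≤-trans (p⊆q⇒∣p∣≤∣q∣ S⊆pencil)
                    (≤-trans (≤-reflexive (replication p)) (≤-trans (≮⇒≥ r≯0) z≤n))
  ... | yes 0<r = hallCondition-byDegrees {{>-nonZero (≤-trans lam≥1 lam≤)}} lam≤
    (≤-reflexive ∘ sym ∘ ∣residual∣) columnDegree S S⊆pencil
    where
    lam≤ : lam ≤ k ∸ 1
    lam≤ = lam≤k∸1 0<r r≤v′
    columnDegree : ∀ q → ∣ pencil ∩ column residual q ∣ ≤ lam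
    columnDegree q rewrite ∣pencil∩column∣ q =
      ≤-trans (*-monoˡ-≤ lam (indicator≤1 (⊤ - p) q)) (≤-reflexive (+-identityʳ lam))

  module _ (r≤v′ : r ≤ v′) where
    private
      module M = Matching (hall residual pencil (hallCondition-pencil r≤v′))

    fromPartner : ∀ q (m : Maybe (Fin b)) → M.partnerOf q ≡ m → Maybe (∃ λ B → q ∈ D B)
    fromPartner q (just B) eq = just (B , p─q⊆p (D B) ⁅ p ⁆ (M.partnerOf-adjacent eq))
    fromPartner q nothing  _  = firstBlock D q

    fromPartner-chosen : ∀ {q C} → q ∈ D C → ∀ m (eq : M.partnerOf q ≡ m) →
                         ∃ λ B → Maybe.map proj₁ (fromPartner q m eq) ≡ just B
    fromPartner-chosen _   (just B) _ = B , refl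
    fromPartner-chosen q∈C nothing  _ = firstBlock-chosen D q∈C

    fromPartner-matched : ∀ {q C} m (eq : M.partnerOf q ≡ m) → m ≡ just C →
                          Maybe.map proj₁ (fromPartner q m eq) ≡ just C
    fromPartner-matched (just _) _ refl = refl

    matchedChoice : BlockChoice D
    matchedChoice q with q ≟ p
    ... | yes _ = nothing
    ... | no  _ = fromPartner q (M.partnerOf q) refl

    matchedChoice-p : matchedChoice p ≡ nothing
    matchedChoice-p with p ≟ p
    ... | yes _   = refl
    ... | no  p≢p = contradiction refl p≢p

    matchedChoice-covering : Covering D matchedChoice
    matchedChoice-covering {x} {C} x∈C with x ≟ p
    ... | no  _    = inj₁ (fromPartner-chosen x∈C (M.partnerOf x) refl)
    ... | yes refl with q , eq ← M.partnerOf-covers (∈-column⁺ {N = D} x∈C) = inj₂ (q , matched)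
      where
      matched : chosenBlock D matchedChoice q ≡ just C
      matched with q ≟ x
      ... | yes refl = contradiction (M.partnerOf-adjacent eq) λ q∈ → x∈p─q⇒x∉q q∈ (x∈⁅x⁆ q)
      ... | no  _    = fromPartner-matched (M.partnerOf q) refl eq

    smallEdgeDomSet : ∃ λ (Γ : EdgeDomSet D) → size Γ < suc v′
    smallEdgeDomSet = chosenEdgeDomSet D matchedChoice matchedChoice-covering ,
                      size-chosenEdgeDomSet-< D matchedChoice matchedChoice-covering matchedChoice-p

edgeDomNumber≤v : ∀ {v b} (D : IncStr v b) → ∃ λ n → IsEdgeDomNumber D n × n ≤ v
edgeDomNumber≤v D =
  let Γ , size≤v     = pointwiseEdgeDomSet D
      n , γ , n≤size = edgeDomNumber D Γ
  in  n , γ , ≤-trans n≤size size≤v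

v≤r⇒isEdgeDomNumber-v : ∀ {v b k r lam} {D : IncStr v b} → IsDesign D k r lam →
                        v ≤ r → IsEdgeDomNumber D v
v≤r⇒isEdgeDomNumber-v {D = D} design v≤r =
  let Γ , size≤v = pointwiseEdgeDomSet D
  in  (Γ , ≤-antisym size≤v (edgeDomSet-size≥ design v≤r Γ)) , edgeDomSet-size≥ design v≤r

isEdgeDomNumber-v⇒v≤r : ∀ {v b k r lam} {D : IncStr v b} → IsDesign D k r lam →
                        IsEdgeDomNumber D v → v ≤ r
isEdgeDomNumber-v⇒v≤r {zero}            _      _             = z≤n
isEdgeDomNumber-v⇒v≤r {suc v′} {r = r} design (_ , minimal) with suc v′ ≤? r
... | yes v≤r = v≤r
... | no  v≰r =
  let Γ , size<v = Pencil.smallEdgeDomSet design zero (≤-pred (≰⇒> v≰r))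
  in  contradiction (minimal Γ) (<⇒≱ size<v)

lemma2p3 : (∀ {v b} (D : IncStr v b) → ∃ λ n → IsEdgeDomNumber D n × n ≤ v)
    × (∀ {v b} (D : IncStr v b) (k r lam : ℕ) → IsDesign D k r lam →
         (IsEdgeDomNumber D v ⇔ r ≥ v))
lemma2p3 = edgeDomNumber≤v , λ D k r lam design →
  mk⇔ (isEdgeDomNumber-v⇒v≤r design) (v≤r⇒isEdgeDomNumber-v design)
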